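{- Let $f:\{0,1\}^n\to\{0,1\}$ be a Boolean function. Then $\mathsf{Pat}^{\mathsf{M}}(f)\geq\mathrm{spar}(f)$.
   Context: Every $f:\{0,1\}^n\to\{0,1\}$ has a unique expansion $f=\sum_{S\subseteq[n]}\widetilde f(S)\mathsf{AND}_S$ with real coefficients, where $\mathsf{AND}_S(x)=\prod_{i\in S}x_i$; the Möbius support is $\mathcal{S}_f=\{S:\widetilde f(S)\neq0\}$ and the Möbius sparsity is $\mathrm{spar}(f)=|\mathcal{S}_f|$. The pattern of $x$ is $(\mathsf{AND}_S(x))_{S\in\mathcal{S}_f}$ and $\mathsf{Pat}^{\mathsf{M}}(f)$ is the number of distinct patterns over all $x\in\{0,1\}^n$. -}

module Defs where

open import Data.Bool using (Bool; true; false; _∧_; _∨_; not)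
open import Data.Bool.Properties using () renaming (_≟_ to _≟ᵇ_)
open import Data.Nat using (ℕ; zero; suc)
open import Data.Integer using (ℤ; _+_; _*_; 0ℤ; 1ℤ)
import Data.Integer as ℤ
open import Data.List using (List; []; _∷_; map; length; filter; deduplicate; _++_; foldr)
open import Data.Vec using (Vec; []; _∷_)
open import Data.Vec.Properties using (≡-dec)
open import Data.List.Properties using () renaming (≡-dec to ≡-decL)
open import Data.Fin.Subset using (Subset)
open import Relation.Nullary using (¬?)
open import Relation.Binary.PropositionalEquality using (_≡_)

-- Inputs x ∈ {0,1}^n are Vec Bool n (true = 1).
-- Subsets S ⊆ [n] are Data.Fin.Subset.Subset n = Vec Bool n (true = "i ∈ S").
BoolFun : ℕ → Set
BoolFun n = Vec Bool n → Bool

allVecs : (n : ℕ) → List (Vec Bool n)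
allVecs zero = [] ∷ []
allVecs (suc n) = map (false ∷_) (allVecs n) ++ map (true ∷_) (allVecs n)

allSubsets : (n : ℕ) → List (Subset n)
allSubsets = allVecs

AND : ∀ {n} → Subset n → Vec Bool n → Bool
AND [] [] = true
AND (s ∷ S) (b ∷ x) = (not s ∨ b) ∧ AND S x

⟦_⟧ : Bool → ℤ
⟦ true ⟧ = 1ℤ
⟦ false ⟧ = 0ℤ

sumℤ : List ℤ → ℤ
sumℤ = foldr _+_ 0ℤ

-- c : Subset n → ℤ is a Möbius expansion of f:  f = Σ_S c(S) AND_S
-- (Möbius coefficients of Boolean functions are integers, and the real
-- expansion is unique, so c is then exactly f̃.)
IsMobiusExpansion : ∀ {n} → BoolFun n → (Subset n → ℤ) → Set
IsMobiusExpansion {n} f c =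
  ∀ x → ⟦ f x ⟧ ≡ sumℤ (map (λ S → c S * ⟦ AND S x ⟧) (allSubsets n))


support : ∀ {n} → (Subset n → ℤ) → List (Subset n)
support {n} c = filter (λ S → ¬? (c S ℤ.≟ 0ℤ)) (allSubsets n)

spar : ∀ {n} → (Subset n → ℤ) → ℕ
spar c = length (support c)

patternOf : ∀ {n} → (Subset n → ℤ) → Vec Bool n → List Bool
patternOf c x = map (λ S → AND S x) (support c)

PatM : ∀ {n} → (Subset n → ℤ) → ℕ
PatM {n} c = length (deduplicate (≡-decL _≟ᵇ_) (map (patternOf c) (allVecs n)))

module Submission where

-- Evaluating AND_T at the indicator vector of S gives 1 exactly when T ⊆ S.
-- So if S ≠ T are both in the support, antisymmetry of ⊆ makes the patterns
-- of their indicator vectors differ at coordinate S or at coordinate T, and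
-- S ↦ pattern(1_S) injects the support into the set of patterns.

open import Defs
open import Data.Nat using (ℕ; _≥_; _≤_; zero; suc; s≤s; z≤n)
open import Data.Nat.Properties using (<-≤-trans; module ≤-Reasoning)
open import Data.Integer using (ℤ)
open import Data.Fin.Subset using (Subset)
open import Data.Bool using (Bool; true; false)
open import Data.Bool.Properties using () renaming (_≟_ to _≟ᵇ_)
open import Data.Vec using (Vec; []; _∷_)
open import Data.Vec.Properties using (∷-injectiveʳ)
open import Data.List using (List; []; _∷_; map; length; filter; deduplicate)
open import Data.List.Properties using (∷-injective; length-map; filter-notAll)
  renaming (≡-dec to ≡-decL)
open import Data.List.Membership.Propositional using (_∈_)
open import Data.List.Membership.Propositional.Properties
  using (∈-map⁺; ∈-map⁻; ∈-filter⁺; ∈-deduplicate⁺; ∈-++⁺ˡ; ∈-++⁺ʳ)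
open import Data.List.Relation.Unary.Any as Any using (Any; here; there)
import Data.List.Relation.Unary.All as All
import Data.List.Relation.Unary.All.Properties as All
open import Data.List.Relation.Unary.AllPairs using ([]; _∷_)
open import Data.List.Relation.Unary.Unique.Propositional using (Unique)
import Data.List.Relation.Unary.Unique.Propositional.Properties as Unique
open import Data.Product using (_×_; _,_; proj₁; proj₂)
open import Function using (_∘_)
open import Relation.Nullary using (¬_; ¬?)
open import Relation.Binary.Definitions using (DecidableEquality)
open import Relation.Binary.PropositionalEquality using (_≡_; refl; sym; trans; cong)

module _ {A : Set} where

  length-mono-⊆-Unique : DecidableEquality A → {xs ys : List A} → Unique xs →
    (∀ {x} → x ∈ xs → x ∈ ys) → length xs ≤ length ys
  length-mono-⊆-Unique _≟_ {[]} _ _ = z≤n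
  -- Deleting x from ys keeps all of xs (x ∉ xs) and strictly shortens ys (x ∈ ys).
  length-mono-⊆-Unique _≟_ {x ∷ xs} {ys} (x∉xs ∷ xs!) xs⊆ys =
    <-≤-trans (s≤s (length-mono-⊆-Unique _≟_ xs! xs⊆ys-x))
              (filter-notAll (¬? ∘ (x ≟_)) ys x∈ys)
    where
    x∈ys : Any (λ y → ¬ ¬ x ≡ y) ys
    x∈ys = Any.map (λ x≡y x≢y → x≢y x≡y) (xs⊆ys (here refl))
    xs⊆ys-x : ∀ {y} → y ∈ xs → y ∈ filter (¬? ∘ (x ≟_)) ys
    xs⊆ys-x y∈xs = ∈-filter⁺ (¬? ∘ (x ≟_)) (xs⊆ys (there y∈xs)) (All.lookup x∉xs y∈xs)

  map-≡⇒≡-on-∈ : {B : Set} (g h : A → B) {xs : List A} →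
    map g xs ≡ map h xs → ∀ {x} → x ∈ xs → g x ≡ h x
  map-≡⇒≡-on-∈ g h eq (here refl) = proj₁ (∷-injective eq)
  map-≡⇒≡-on-∈ g h eq (there x∈xs) = map-≡⇒≡-on-∈ g h (proj₂ (∷-injective eq)) x∈xs

  Unique-map⁺-injectiveOn : {B : Set} (g : A → B) {xs : List A} →
    (∀ {a b} → a ∈ xs → b ∈ xs → g a ≡ g b → a ≡ b) → Unique xs → Unique (map g xs)
  Unique-map⁺-injectiveOn g _ [] = []
  Unique-map⁺-injectiveOn g inj (x∉xs ∷ xs!) =
    All.map⁺ (All.tabulate λ y∈xs gx≡gy →
                All.lookup x∉xs y∈xs (inj (here refl) (there y∈xs) gx≡gy))
    ∷ Unique-map⁺-injectiveOn g (λ a∈ b∈ → inj (there a∈) (there b∈)) xs!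

∈-allVecs : ∀ {n} (x : Vec Bool n) → x ∈ allVecs n
∈-allVecs [] = here refl
∈-allVecs {suc n} (false ∷ x) = ∈-++⁺ˡ (∈-map⁺ (false ∷_) (∈-allVecs x))
∈-allVecs {suc n} (true ∷ x) =
  ∈-++⁺ʳ (map (false ∷_) (allVecs n)) (∈-map⁺ (true ∷_) (∈-allVecs x))

allVecs-Unique : ∀ n → Unique (allVecs n)
allVecs-Unique zero = All.[] ∷ []
allVecs-Unique (suc n) =
  Unique.++⁺ (Unique.map⁺ ∷-injectiveʳ (allVecs-Unique n))
             (Unique.map⁺ ∷-injectiveʳ (allVecs-Unique n))
             disjoint
  where
  disjoint : ∀ {x} → ¬ (x ∈ map (false ∷_) (allVecs n) × x ∈ map (true ∷_) (allVecs n))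
  disjoint (p , q) with ∈-map⁻ (false ∷_) p | ∈-map⁻ (true ∷_) q
  ... | _ , _ , refl | _ , _ , ()

AND-self : ∀ {n} (S : Subset n) → AND S S ≡ true
AND-self [] = refl
AND-self (true ∷ S) = AND-self S
AND-self (false ∷ S) = AND-self S

AND-antisym : ∀ {n} (S T : Subset n) → AND S T ≡ true → AND T S ≡ true → S ≡ T
AND-antisym [] [] _ _ = refl
AND-antisym (true ∷ S) (true ∷ T) p q = cong (true ∷_) (AND-antisym S T p q)
AND-antisym (false ∷ S) (false ∷ T) p q = cong (false ∷_) (AND-antisym S T p q)
AND-antisym (true ∷ S) (false ∷ T) () _
AND-antisym (false ∷ S) (true ∷ T) _ ()

-- Subset n and Vec Bool n coincide, so the indicator vector of S is S itself.
patternOf-injectiveOn-support : ∀ {n} (c : Subset n → ℤ) {S T : Subset n} →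
  S ∈ support c → T ∈ support c → patternOf c S ≡ patternOf c T → S ≡ T
patternOf-injectiveOn-support c {S} {T} S∈ T∈ eq =
  AND-antisym S T (trans (sym (pattern-agrees S∈)) (AND-self S))
                  (trans (pattern-agrees T∈) (AND-self T))
  where
  pattern-agrees : ∀ {U} → U ∈ support c → AND U S ≡ AND U T
  pattern-agrees = map-≡⇒≡-on-∈ (λ U → AND U S) (λ U → AND U T) eq

support-Unique : ∀ {n} (c : Subset n → ℤ) → Unique (support c)
support-Unique {n} c = Unique.filter⁺ _ (allVecs-Unique n)

claim6 : (n : ℕ) (f : BoolFun n) (c : Subset n → ℤ) →
    IsMobiusExpansion f c → PatM c ≥ spar c
claim6 n f c _ = begin
  spar c                                 ≡⟨ sym (length-map (patternOf c) (support c)) ⟩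
  length (map (patternOf c) (support c)) ≤⟨ length-mono-⊆-Unique (≡-decL _≟ᵇ_)
                                              patterns-Unique patterns-realised ⟩
  PatM c                                 ∎
  where
  open ≤-Reasoning
  patterns-Unique : Unique (map (patternOf c) (support c))
  patterns-Unique =
    Unique-map⁺-injectiveOn (patternOf c) (patternOf-injectiveOn-support c) (support-Unique c)
  patterns-realised : ∀ {p} → p ∈ map (patternOf c) (support c) →
    p ∈ deduplicate (≡-decL _≟ᵇ_) (map (patternOf c) (allVecs n))
  patterns-realised p∈ with ∈-map⁻ (patternOf c) p∈
  ... | S , _ , refl = ∈-deduplicate⁺ (≡-decL _≟ᵇ_) (∈-map⁺ (patternOf c) (∈-allVecs S))
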